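{- Let $G$ be a connected graph of order $n$, let $\alpha$ be an ordering of $G$, and let $(\{x\},Y)$ be an $\alpha$-consecutive pair such that $x$ has a neighbor $z$ of degree $1$ with $\alpha(z)>\alpha(y)$ for all $y\in Y$. If $|E^l_\alpha(Y)|\ge |E^r_\alpha(Y)|$, then for $\beta=\mathrm{swap}_{Y,\{x\}}(\alpha)$ we have $\mathrm{prf}_\beta(G)\le \mathrm{prf}_\alpha(G)$.
   Context: An ordering of $G=(V,E)$ is a bijection $\alpha:V\to\{1,\dots,n\}$; with $N[v]=\{v\}\cup\{u:uv\in E\}$, $\mathrm{prf}_\alpha(G)=\sum_{v\in V}(\alpha(v)-\min\{\alpha(u):u\in N[v]\})$. $E_\alpha(G)$ is the set of edges $uv$ of $G$ such that $u\neq v$ and $\alpha(u)=\min_{w\in N[v]}\alpha(w)$. For $X\subseteq V$, $E^r_\alpha(X)$ (resp. $E^l_\alpha(X)$) is the set of edges $uv\in E_\alpha(G)$ with $u\in X$, $v\in V\setminus X$ and $\alpha(u)<\alpha(v)$ (resp. $\alpha(u)>\alpha(v)$). Two disjoint sets $X,Y\subseteq V$ form an $\alpha$-consecutive pair $(X,Y)$ if there are integers $1\le a<b<c\le n$ with $X=\{x:a\le\alpha(x)\le b-1\}$ and $Y=\{y: b\le \alpha(y)\le c\}$. Then $\mathrm{swap}_{Y,X}(\alpha)$ is the ordering that agrees with $\alpha$ outside $X\cup Y$, places the vertices of $Y$ at positions $a,\dots,a+|Y|-1$ and those of $X$ at positions $a+|Y|,\dots,c$, each block keeping its internal relative order. 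-}

module Defs where

open import Data.Nat using (ℕ; zero; suc; _+_; _∸_; _≤_; _<_; _≤ᵇ_; _<ᵇ_; _≡ᵇ_; _⊓_)
open import Data.Fin using (Fin; toℕ; _≟_)
open import Data.Fin.Permutation using (Permutation′; _⟨$⟩ʳ_)
open import Data.Fin.Subset using (Subset; _∈_; _∉_)
open import Data.List using (List; []; _∷_; foldr; length; filter; allFin; cartesianProduct)
open import Data.Bool using (Bool; true; false; T; _∧_; _∨_; not; if_then_else_)
open import Data.Product using (_×_; _,_; proj₁; proj₂; Σ)
open import Relation.Binary.PropositionalEquality using (_≡_)
open import Relation.Nullary.Decidable using (does; ⌊_⌋)
open import Data.Sum using (_⊎_)
open import Function.Bundles using (_⇔_)

record Graph (n : ℕ) : Set where
  field
    adj     : Fin n → Fin n → Bool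
    adj-sym : ∀ u v → adj u v ≡ adj v u
    irrefl  : ∀ v → adj v v ≡ false
open Graph public

data Reach {n : ℕ} (G : Graph n) (u : Fin n) : Fin n → Set where
  here : Reach G u u
  step : ∀ {v w} → Reach G u v → T (adj G v w) → Reach G u w

Connected : {n : ℕ} → Graph n → Set
Connected {n} G = ∀ (u v : Fin n) → Reach G u v

inN : {n : ℕ} → Graph n → Fin n → Fin n → Bool
inN G v w = ⌊ w ≟ v ⌋ ∨ adj G v w

degree : {n : ℕ} → Graph n → Fin n → ℕ
degree {n} G v = length (filter (λ u → T? (adj G v u)) (allFin n))
  where
  open import Relation.Nullary.Decidable using (Dec)
  open import Data.Bool.Properties using () renaming (T? to T?)

-- Positions: an ordering is a bijection V → {1,…,n}; we use a permutation of
-- Fin n and shift by one, so positions range over 1 … n.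
Ordering : ℕ → Set
Ordering n = Permutation′ n

pos : {n : ℕ} → Ordering n → Fin n → ℕ
pos α v = suc (toℕ (α ⟨$⟩ʳ v))

-- min { f u : u ∈ N[v] }  (N[v] contains v, so start from f v)
minN : {n : ℕ} → Graph n → (Fin n → ℕ) → Fin n → ℕ
minN {n} G f v = foldr (λ u m → if inN G v u then f u ⊓ m else m) (f v) (allFin n)

sumV : {n : ℕ} → (Fin n → ℕ) → ℕ
sumV {n} g = foldr (λ v s → g v + s) 0 (allFin n)

prfF : {n : ℕ} → Graph n → (Fin n → ℕ) → ℕ
prfF G f = sumV (λ v → f v ∸ minN G f v)

prf : {n : ℕ} → Graph n → Ordering n → ℕ
prf G α = prfF G (pos α)

inEα : {n : ℕ} → Graph n → Ordering n → Fin n → Fin n → Bool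
inEα G α u v = not ⌊ u ≟ v ⌋ ∧ adj G u v
  ∧ ((pos α u ≡ᵇ minN G (pos α) v) ∨ (pos α v ≡ᵇ minN G (pos α) u))

memb : {n : ℕ} → Subset n → Fin n → Bool
memb X v = Data.Vec.lookup X v
  where import Data.Vec

-- each edge uv with u ∈ X, v ∉ X is listed once, as the ordered pair (u , v)
Er : {n : ℕ} → Graph n → Ordering n → Subset n → ℕ
Er {n} G α X = length (filter (λ p → Data.Bool.Properties.T? (cond (proj₁ p) (proj₂ p)))
                              (cartesianProduct (allFin n) (allFin n)))
  where
  import Data.Bool.Properties
  cond : Fin n → Fin n → Bool
  cond u v = inEα G α u v ∧ memb X u ∧ not (memb X v) ∧ (pos α u <ᵇ pos α v)

El : {n : ℕ} → Graph n → Ordering n → Subset n → ℕ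
El {n} G α X = length (filter (λ p → Data.Bool.Properties.T? (cond (proj₁ p) (proj₂ p)))
                              (cartesianProduct (allFin n) (allFin n)))
  where
  import Data.Bool.Properties
  cond : Fin n → Fin n → Bool
  cond u v = inEα G α u v ∧ memb X u ∧ not (memb X v) ∧ (pos α v <ᵇ pos α u)

ConsecutivePairAt : {n : ℕ} → Ordering n → Subset n → Subset n → ℕ → ℕ → ℕ → Set
ConsecutivePairAt {n} α X Y a b c =
  (1 ≤ a) × (a < b) × (b < c) × (c ≤ n)
  × (∀ v → T (memb X v) ⇔ ((a ≤ pos α v) × (pos α v ≤ b ∸ 1)))
  × (∀ v → T (memb Y v) ⇔ ((b ≤ pos α v) × (pos α v ≤ c)))

-- the new position of a vertex that was at position p under α, for swap_{Y,X}
swapPos : ℕ → ℕ → ℕ → ℕ → ℕ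
swapPos a b c p =
  if (a ≤ᵇ p) ∧ (p <ᵇ b) then p + (c + 1 ∸ b)          -- X-block: a + |Y| + (p - a)
  else if (b ≤ᵇ p) ∧ (p ≤ᵇ c) then p ∸ (b ∸ a)       -- Y-block: a + (p - b)
  else p

swapYX : {n : ℕ} → Ordering n → ℕ → ℕ → ℕ → Fin n → ℕ
swapYX α a b c v = swapPos a b c (pos α v)

-- Let x sit at position a, so that Y occupies positions a+1, …, c. Under β the vertex x
-- moves to c, each vertex of Y moves one step left, and all other vertices stay. Hence
-- min_β N[v] ≥ min_α N[v] − ℓ(v), where ℓ(v) holds when the α-leftmost vertex of N[v]
-- lies in Y. So the profile term of a vertex v ∈ Y drops by at least 1 − ℓ(v), that of a
-- vertex v ∉ Y other than x grows by at most ℓ(v), and that of x grows by at most c − a;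
-- the leaf z, whose closed neighbourhood is {x, z}, pays this back, since its minimum moves
-- from at most a to c. An edge of E^l_α(Y) at u ∈ Y goes to the α-leftmost vertex of N[u],
-- which lies outside Y, so there are at most as many such edges as vertices u ∈ Y without
-- ℓ(u); and every v ∉ Y with ℓ(v) has its own edge of E^r_α(Y). Hence
-- |E^r_α(Y)| ≤ |E^l_α(Y)| makes the total change nonpositive.

module Submission where

open import Defs
open import Data.Nat using (ℕ; _≤_; _<_)
open import Data.Fin using (Fin)
open import Data.Fin.Subset using (Subset; ⁅_⁆)
open import Data.Bool using (T)
open import Relation.Binary.PropositionalEquality using (_≡_)

open import Data.Bool using (Bool; true; false; _∧_; _∨_; not; if_then_else_)
open import Data.Bool.Properties using (T?; T-∨; T-≡)
open import Data.Fin using (zero; suc; punchIn; _≟_; toℕ; fromℕ<)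
import Data.Fin.Properties as Finₚ
open import Data.Fin.Permutation using (_⟨$⟩ʳ_; _⟨$⟩ˡ_; inverseˡ; inverseʳ)
open import Data.Fin.Subset.Properties using (x∈⁅y⁆⇒x≡y)
open import Data.List using (List; []; _∷_; foldr; allFin; length; filter; tabulate; map; _++_; cartesianProduct)
open import Data.List.Membership.Propositional using (_∈_)
open import Data.List.Membership.Propositional.Properties using (∈-allFin; ∈-filter⁺)
open import Data.List.Properties using (filter-++; length-++; map-tabulate)
open import Data.List.Relation.Unary.Any using (here; there)
import Data.Nat as ℕ
open import Data.Nat using (zero; suc; _+_; _∸_; _⊓_; _≤ᵇ_; _<ᵇ_; z≤n; s≤s; s≤s⁻¹; _≤?_; _<?_)
open import Data.Nat.Properties hiding (_≟_)
open import Algebra.Properties.CommutativeMonoid.Sum +-0-commutativeMonoid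
  using (sum; sum-syntax; sum-remove; sum-cong-≗; sum-replicate-zero; ∑-distrib-+; ∑-comm)
open import Data.Nat.Tactic.RingSolver using (solve-∀)
open import Data.Product using (_×_; _,_; proj₁; proj₂; Σ-syntax)
open import Data.Sum as Sum using (_⊎_; inj₁; inj₂)
open import Data.Unit using (tt)
open import Data.Vec.Functional using (removeAt)
open import Data.Vec.Properties using (lookup⇒[]=)
open import Function using (_∘_; id)
open import Function.Bundles using (_⇔_; Equivalence)
open import Relation.Binary.Definitions using (tri<; tri≈; tri>)
open import Relation.Binary.PropositionalEquality using (refl; sym; trans; cong; cong₂; subst; _≢_; module ≡-Reasoning)
open import Relation.Nullary using (¬_; Dec; does; yes; no; contradiction)
open import Relation.Nullary.Decidable using (⌊_⌋; _×-dec_; fromWitness; toWitness; dec-true; dec-false; dec-no)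

T⇒≡true : ∀ {b} → T b → b ≡ true
T⇒≡true = Equivalence.to T-≡

≡true⇒T : ∀ {b} → b ≡ true → T b
≡true⇒T = Equivalence.from T-≡

¬T⇒≡false : ∀ {b} → ¬ T b → b ≡ false
¬T⇒≡false {false} _   = refl
¬T⇒≡false {true}  ¬tt = contradiction tt ¬tt

T-∧⁻ : ∀ b {b′} → T (b ∧ b′) → T b × T b′
T-∧⁻ true t = tt , t

T-∨⁻ : ∀ {b b′} → T (b ∨ b′) → T b ⊎ T b′
T-∨⁻ {b} = Equivalence.to (T-∨ {b})

T-not⁻ : ∀ {b} → T (not b) → ¬ T b
T-not⁻ {false} _ ()

T-does⁻ : ∀ {A : Set} (a? : Dec A) → T (does a?) → A
T-does⁻ (yes a) _ = a

indicator : Bool → ℕ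
indicator true  = 1
indicator false = 0

≤ᵇ-true : ∀ {m n} → m ≤ n → (m ≤ᵇ n) ≡ true
≤ᵇ-true m≤n = T⇒≡true (≤⇒≤ᵇ m≤n)

<ᵇ-true : ∀ {m n} → m < n → (m <ᵇ n) ≡ true
<ᵇ-true m<n = T⇒≡true (<⇒<ᵇ m<n)

≤ᵇ-false : ∀ {m n} → n < m → (m ≤ᵇ n) ≡ false
≤ᵇ-false n<m = dec-false (_ ≤? _) (<⇒≱ n<m)

<ᵇ-false : ∀ {m n} → n ≤ m → (m <ᵇ n) ≡ false
<ᵇ-false n≤m = ≤ᵇ-false (s≤s n≤m)

clear-∸-≤ : ∀ {p q r s t u} → q ≤ p → t ≤ s → p + t + r ≤ s + q + u → p ∸ q + r ≤ s ∸ t + u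
clear-∸-≤ {p} {q} {r} {s} {t} {u} q≤p t≤s le = +-cancelʳ-≤ (q + t) (p ∸ q + r) (s ∸ t + u) (begin
  p ∸ q + r + (q + t)       ≡⟨ regroup (p ∸ q) q t r ⟩
  p ∸ q + q + t + r         ≡⟨ cong (λ w → w + t + r) (m∸n+n≡m q≤p) ⟩
  p + t + r                 ≤⟨ le ⟩
  s + q + u                 ≡⟨ cong (λ w → w + q + u) (m∸n+n≡m t≤s) ⟨
  s ∸ t + t + q + u         ≡⟨ regroup (s ∸ t) t q u ⟨
  s ∸ t + u + (t + q)       ≡⟨ cong (s ∸ t + u +_) (+-comm t q) ⟩
  s ∸ t + u + (q + t)       ∎)
  where
  open ≤-Reasoning
  regroup : ∀ d x y e → d + e + (x + y) ≡ d + x + y + e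
  regroup = solve-∀

foldr-+-tabulate : ∀ {A : Set} {m} (h : A → ℕ) (f : Fin m → A) →
  foldr (λ v s → h v + s) 0 (tabulate f) ≡ sum (h ∘ f)
foldr-+-tabulate {m = zero}  h f = refl
foldr-+-tabulate {m = suc m} h f = cong (h (f zero) +_) (foldr-+-tabulate h (f ∘ suc))

sumV≡sum : ∀ {n} (h : Fin n → ℕ) → sumV h ≡ sum h
sumV≡sum h = foldr-+-tabulate h id

sum-mono-≤ : ∀ {m} {f g : Fin m → ℕ} → (∀ i → f i ≤ g i) → sum f ≤ sum g
sum-mono-≤ {zero}  f≤g = z≤n
sum-mono-≤ {suc m} f≤g = +-mono-≤ (f≤g zero) (sum-mono-≤ (f≤g ∘ suc))

≤-sum : ∀ {m} (f : Fin m → ℕ) i → f i ≤ sum f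
≤-sum {suc _} f i = ≤-trans (m≤m+n (f i) _) (≤-reflexive (sym (sum-remove f)))

sum-pointSupported : ∀ {m} (f : Fin m → ℕ) i → (∀ j → j ≢ i → f j ≡ 0) → sum f ≡ f i
sum-pointSupported {suc m} f i f≡0 = begin
  sum f                        ≡⟨ sum-remove f ⟩
  f i + sum (removeAt f i)     ≡⟨ cong (f i +_) (sum-cong-≗ (λ j → f≡0 (punchIn i j) (Finₚ.punchInᵢ≢i i j))) ⟩
  f i + sum {m} (λ _ → 0)      ≡⟨ cong (f i +_) (sum-replicate-zero m) ⟩
  f i + 0                      ≡⟨ +-identityʳ (f i) ⟩
  f i                          ∎
  where open ≡-Reasoning

pointMass : ∀ {m} → Fin m → ℕ → Fin m → ℕ
pointMass i k j = if ⌊ j ≟ i ⌋ then k else 0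

pointMass-at : ∀ {m} (i : Fin m) k → pointMass i k i ≡ k
pointMass-at i k with i ≟ i
... | yes _   = refl
... | no  i≢i = contradiction refl i≢i

pointMass-off : ∀ {m} {i j : Fin m} k → j ≢ i → pointMass i k j ≡ 0
pointMass-off {i = i} {j} k j≢i with j ≟ i
... | yes j≡i = contradiction j≡i j≢i
... | no  _   = refl

sum-pointMass : ∀ {m} (i : Fin m) k → sum (pointMass i k) ≡ k
sum-pointMass i k = trans (sum-pointSupported (pointMass i k) i (λ j → pointMass-off k)) (pointMass-at i k)

sum-≤-transfer : ∀ {m} {L R : Fin m → ℕ} {x z} k → x ≢ z →
  L x ≤ R x + k → L z + k ≤ R z → (∀ v → v ≢ x → v ≢ z → L v ≤ R v) → sum L ≤ sum R
sum-≤-transfer {L = L} {R} {x} {z} k x≢z at-x at-z elsewhere = +-cancelʳ-≤ k (sum L) (sum R) (begin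
  sum L + k                          ≡⟨ cong (sum L +_) (sum-pointMass z k) ⟨
  sum L + sum (pointMass z k)        ≡⟨ ∑-distrib-+ L (pointMass z k) ⟨
  sum (λ v → L v + pointMass z k v)  ≤⟨ sum-mono-≤ pointwise ⟩
  sum (λ v → R v + pointMass x k v)  ≡⟨ ∑-distrib-+ R (pointMass x k) ⟩
  sum R + sum (pointMass x k)        ≡⟨ cong (sum R +_) (sum-pointMass x k) ⟩
  sum R + k                          ∎)
  where
  open ≤-Reasoning
  pointwise : ∀ v → L v + pointMass z k v ≤ R v + pointMass x k v
  pointwise v with v ≟ x | v ≟ z
  ... | yes refl | yes refl = contradiction refl x≢z
  ... | yes refl | no _     = ≤-trans (≤-reflexive (+-identityʳ (L x))) at-x
  ... | no _     | yes refl = ≤-trans at-z (≤-reflexive (sym (+-identityʳ (R z))))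
  ... | no v≢x   | no v≢z   = +-monoˡ-≤ 0 (elsewhere v v≢x v≢z)

indicator-≤-sum : ∀ {m} {b} (k : Fin m → Bool) → (T b → Σ[ i ∈ Fin m ] T (k i)) →
  indicator b ≤ sum (indicator ∘ k)
indicator-≤-sum {b = false} k witness = z≤n
indicator-≤-sum {b = true}  k witness with witness tt
... | i , ki = ≤-trans (≤-reflexive (sym (cong indicator (T⇒≡true ki)))) (≤-sum (indicator ∘ k) i)

sum-indicator-≤ : ∀ {m} {b} (k : Fin m → Bool) → (∀ i → T (k i) → T b) →
  (∀ i j → T (k i) → T (k j) → i ≡ j) → sum (indicator ∘ k) ≤ indicator b
sum-indicator-≤ {zero}  k only-if unique = z≤n
sum-indicator-≤ {suc m} {b} k only-if unique with k zero in k₀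
... | false = sum-indicator-≤ (k ∘ suc) (only-if ∘ suc)
                (λ i j ki kj → Finₚ.suc-injective (unique (suc i) (suc j) ki kj))
... | true  with b | only-if zero (≡true⇒T k₀)
...   | true | _ = s≤s (sum-indicator-≤ {b = false} (k ∘ suc)
                          (λ i ki → Finₚ.0≢1+n (unique zero (suc i) (≡true⇒T k₀) ki))
                          (λ i j ki kj → Finₚ.suc-injective (unique (suc i) (suc j) ki kj)))

length-filter-tabulate : ∀ {A : Set} {m} (k : A → Bool) (f : Fin m → A) →
  length (filter (T? ∘ k) (tabulate f)) ≡ sum (indicator ∘ k ∘ f)
length-filter-tabulate {m = zero}  k f = refl
length-filter-tabulate {m = suc m} k f with k (f zero)
... | true  = cong suc (length-filter-tabulate k (f ∘ suc))
... | false = length-filter-tabulate k (f ∘ suc)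

length-filter-cartesianProduct : ∀ {A B : Set} {m n} (k : A × B → Bool) (f : Fin m → A) (g : Fin n → B) →
  length (filter (T? ∘ k) (cartesianProduct (tabulate f) (tabulate g)))
    ≡ ∑[ i < m ] ∑[ j < n ] indicator (k (f i , g j))
length-filter-cartesianProduct {m = zero}  k f g = refl
length-filter-cartesianProduct {m = suc m} k f g = begin
  length (filter (T? ∘ k) (row ++ rest))
    ≡⟨ cong length (filter-++ (T? ∘ k) row rest) ⟩
  length (filter (T? ∘ k) row ++ filter (T? ∘ k) rest)
    ≡⟨ length-++ (filter (T? ∘ k) row) ⟩
  length (filter (T? ∘ k) row) + length (filter (T? ∘ k) rest)
    ≡⟨ cong₂ _+_ (trans (cong (length ∘ filter (T? ∘ k)) (map-tabulate g (f zero ,_)))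
                        (length-filter-tabulate k (λ j → f zero , g j)))
                 (length-filter-cartesianProduct k (f ∘ suc) g) ⟩
  ∑[ i < suc m ] ∑[ j < _ ] indicator (k (f i , g j)) ∎
  where
  open ≡-Reasoning
  row  = map (f zero ,_) (tabulate g)
  rest = cartesianProduct (tabulate (f ∘ suc)) (tabulate g)

length≡1⇒∈-unique : ∀ {A : Set} {xs : List A} {y y′} → length xs ≡ 1 → y ∈ xs → y′ ∈ xs → y ≡ y′
length≡1⇒∈-unique {xs = _ ∷ []} _ (here refl) (here refl) = refl

module _ {n : ℕ} (G : Graph n) where

  inN-refl : ∀ v → T (inN G v v)
  inN-refl v = Equivalence.from (T-∨ {⌊ v ≟ v ⌋}) (inj₁ (fromWitness refl))

  adj⇒inN : ∀ {v w} → T (adj G v w) → T (inN G v w)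
  adj⇒inN {v} {w} v~w = Equivalence.from (T-∨ {⌊ w ≟ v ⌋}) (inj₂ v~w)

  inN⇒≡⊎adj : ∀ {v w} → T (inN G v w) → w ≡ v ⊎ T (adj G v w)
  inN⇒≡⊎adj {v} {w} w∈N[v] = Sum.map₁ toWitness (Equivalence.to (T-∨ {⌊ w ≟ v ⌋}) w∈N[v])

  module _ (h : Fin n → ℕ) (v : Fin n) where

    private
      minStep : Fin n → ℕ → ℕ
      minStep u m = if inN G v u then h u ⊓ m else m

      foldr-min-≤ : ∀ {u} xs init → u ∈ xs → T (inN G v u) → foldr minStep init xs ≤ h u
      foldr-min-≤ (y ∷ ys) init (here refl) u∈N[v] rewrite T⇒≡true u∈N[v] = m⊓n≤m (h y) _
      foldr-min-≤ (y ∷ ys) init (there u∈ys) u∈N[v] with inN G v y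
      ... | true  = ≤-trans (m⊓n≤n (h y) _) (foldr-min-≤ ys init u∈ys u∈N[v])
      ... | false = foldr-min-≤ ys init u∈ys u∈N[v]

      ≤-foldr-min : ∀ {t} xs init → t ≤ init → (∀ u → T (inN G v u) → t ≤ h u) → t ≤ foldr minStep init xs
      ≤-foldr-min []       init t≤init t≤N = t≤init
      ≤-foldr-min (y ∷ ys) init t≤init t≤N with inN G v y in y∈N[v]
      ... | true  = ⊓-glb (t≤N y (≡true⇒T y∈N[v])) (≤-foldr-min ys init t≤init t≤N)
      ... | false = ≤-foldr-min ys init t≤init t≤N

      foldr-min-attained : ∀ xs init →
        foldr minStep init xs ≡ init ⊎ Σ[ u ∈ Fin n ] T (inN G v u) × foldr minStep init xs ≡ h u
      foldr-min-attained []       init = inj₁ refl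
      foldr-min-attained (y ∷ ys) init with inN G v y in y∈N[v]
      ... | false = foldr-min-attained ys init
      ... | true with ≤-total (h y) (foldr minStep init ys)
      ...   | inj₁ hy≤ = inj₂ (y , ≡true⇒T y∈N[v] , m≤n⇒m⊓n≡m hy≤)
      ...   | inj₂ ≤hy rewrite m≥n⇒m⊓n≡n ≤hy = foldr-min-attained ys init

    minN-≤ : ∀ {u} → T (inN G v u) → minN G h v ≤ h u
    minN-≤ = foldr-min-≤ (allFin n) (h v) (∈-allFin _)

    minN-≤-self : minN G h v ≤ h v
    minN-≤-self = minN-≤ (inN-refl v)

    ≤-minN : ∀ {t} → (∀ u → T (inN G v u) → t ≤ h u) → t ≤ minN G h v
    ≤-minN t≤N = ≤-foldr-min (allFin n) (h v) (t≤N v (inN-refl v)) t≤N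

    minN-attained : Σ[ u ∈ Fin n ] T (inN G v u) × minN G h v ≡ h u
    minN-attained with foldr-min-attained (allFin n) (h v)
    ... | inj₁ min≡hv = v , inN-refl v , min≡hv
    ... | inj₂ attained = attained

  degree≡1⇒adj-unique : ∀ {z u w} → degree G z ≡ 1 → T (adj G z u) → T (adj G z w) → u ≡ w
  degree≡1⇒adj-unique {z} deg≡1 z~u z~w = length≡1⇒∈-unique deg≡1 (neighbour∈ z~u) (neighbour∈ z~w)
    where
    neighbour∈ : ∀ {y} → T (adj G z y) → y ∈ filter (T? ∘ adj G z) (allFin n)
    neighbour∈ z~y = ∈-filter⁺ (T? ∘ adj G z) (∈-allFin _) z~y

module _ {n : ℕ} (α : Ordering n) where

  pos-injective : ∀ {u v} → pos α u ≡ pos α v → u ≡ v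
  pos-injective {u} {v} eq = begin
    u                              ≡⟨ inverseˡ α ⟨
    α ⟨$⟩ˡ (α ⟨$⟩ʳ u)              ≡⟨ cong (α ⟨$⟩ˡ_) (Finₚ.toℕ-injective (suc-injective eq)) ⟩
    α ⟨$⟩ˡ (α ⟨$⟩ʳ v)              ≡⟨ inverseˡ α ⟩
    v                              ∎
    where open ≡-Reasoning

  pos-surjective : ∀ {p} → 1 ≤ p → p ≤ n → Σ[ v ∈ Fin n ] pos α v ≡ p
  pos-surjective {suc p} _ p<n =
    α ⟨$⟩ˡ fromℕ< p<n , cong suc (trans (cong toℕ (inverseʳ α)) (Finₚ.toℕ-fromℕ< p<n))

memb-⁅⁆⇒≡ : ∀ {n} {x v : Fin n} → T (memb ⁅ x ⁆ v) → v ≡ x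
memb-⁅⁆⇒≡ {x = x} {v} v∈⁅x⁆ = x∈⁅y⁆⇒x≡y x (lookup⇒[]= v ⁅ x ⁆ (T⇒≡true v∈⁅x⁆))

InBlock : ℕ → ℕ → ℕ → Set
InBlock a c p = a < p × p ≤ c

inBlock? : ∀ a c p → Dec (InBlock a c p)
inBlock? a c p = a <? p ×-dec p ≤? c

data Region (a c p : ℕ) : Set where
  before   : p < a → Region a c p
  at       : p ≡ a → Region a c p
  inside   : a < p → p ≤ c → Region a c p
  after    : c < p → Region a c p

region : ∀ a c p → Region a c p
region a c p with <-cmp p a | p ≤? c
... | tri< p<a _ _ | _       = before p<a
... | tri≈ _ p≡a _ | _       = at p≡a
... | tri> _ _ a<p | yes p≤c = inside a<p p≤c
... | tri> _ _ a<p | no  p≰c = after (≰⇒> p≰c)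

module _ {a c : ℕ} where

  swapPos-before : ∀ {p} → p < a → swapPos a (suc a) c p ≡ p
  swapPos-before p<a rewrite ≤ᵇ-false p<a | ≤ᵇ-false (m<n⇒m<1+n p<a) = refl

  swapPos-at : a ≤ c → swapPos a (suc a) c a ≡ c
  swapPos-at a≤c rewrite ≤ᵇ-true (≤-refl {a}) | <ᵇ-true (n<1+n a) | +-comm c 1 = m+[n∸m]≡n a≤c

  swapPos-inside : ∀ {p} → a < p → p ≤ c → suc (swapPos a (suc a) c p) ≡ p
  swapPos-inside {suc p} a<p p≤c
    rewrite ≤ᵇ-true (<⇒≤ a<p) | <ᵇ-false a<p | ≤ᵇ-true a<p | ≤ᵇ-true p≤c | m+n∸n≡m 1 a = refl

  swapPos-after : ∀ {p} → a ≤ c → c < p → swapPos a (suc a) c p ≡ p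
  swapPos-after {p} a≤c c<p = unfold (≤-<-trans a≤c c<p)
    where
    unfold : a < p → swapPos a (suc a) c p ≡ p
    unfold a<p rewrite ≤ᵇ-true (<⇒≤ a<p) | <ᵇ-false a<p | ≤ᵇ-true a<p | ≤ᵇ-false c<p = refl

  ≤-suc-swapPos : a ≤ c → ∀ p → p ≤ suc (swapPos a (suc a) c p)
  ≤-suc-swapPos a≤c p with region a c p
  ... | before p<a     = ≤-trans (n≤1+n p) (≤-reflexive (cong suc (sym (swapPos-before p<a))))
  ... | at refl        = ≤-trans a≤c (≤-trans (n≤1+n c) (≤-reflexive (cong suc (sym (swapPos-at a≤c)))))
  ... | inside a<p p≤c = ≤-reflexive (sym (swapPos-inside a<p p≤c))
  ... | after c<p      = ≤-trans (n≤1+n p) (≤-reflexive (cong suc (sym (swapPos-after a≤c c<p))))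

  ≤-swapPos-outsideBlock : a ≤ c → ∀ {t p} → ¬ InBlock a c t → t ≤ p → t ≤ swapPos a (suc a) c p
  ≤-swapPos-outsideBlock a≤c {t} {p} t∉block t≤p with region a c p
  ... | before p<a     = ≤-trans t≤p (≤-reflexive (sym (swapPos-before p<a)))
  ... | at refl        = ≤-trans t≤p (≤-trans a≤c (≤-reflexive (sym (swapPos-at a≤c))))
  ... | after c<p      = ≤-trans t≤p (≤-reflexive (sym (swapPos-after a≤c c<p)))
  ... | inside a<p p≤c with a <? t
  ...   | yes a<t = contradiction (a<t , ≤-trans t≤p p≤c) t∉block
  ...   | no  a≮t = ≤-trans (≮⇒≥ a≮t) (s≤s⁻¹ (≤-trans a<p (≤-reflexive (sym (swapPos-inside a<p p≤c)))))

module _ {n : ℕ} (G : Graph n) (α : Ordering n) (X : Subset n) where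

  isRightEdge isLeftEdge : Fin n → Fin n → Bool
  isRightEdge u v = inEα G α u v ∧ memb X u ∧ not (memb X v) ∧ (pos α u <ᵇ pos α v)
  isLeftEdge  u v = inEα G α u v ∧ memb X u ∧ not (memb X v) ∧ (pos α v <ᵇ pos α u)

  Er≡∑∑ : Er G α X ≡ ∑[ u < n ] ∑[ v < n ] indicator (isRightEdge u v)
  Er≡∑∑ = length-filter-cartesianProduct (λ (u , v) → isRightEdge u v) id id

  El≡∑∑ : El G α X ≡ ∑[ u < n ] ∑[ v < n ] indicator (isLeftEdge u v)
  El≡∑∑ = length-filter-cartesianProduct (λ (u , v) → isLeftEdge u v) id id

  isRightEdge-intro : ∀ {u v} → T (memb X u) → ¬ T (memb X v) → T (adj G u v) →
    pos α u ≡ minN G (pos α) v → T (isRightEdge u v)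
  isRightEdge-intro {u} {v} u∈X v∉X u~v u-leftmost = decide u≢v u<v
    where
    u≢v : u ≢ v
    u≢v refl = v∉X u∈X
    u<v : pos α u < pos α v
    u<v = ≤∧≢⇒< (≤-trans (≤-reflexive u-leftmost) (minN-≤-self G (pos α) v)) (u≢v ∘ pos-injective α)
    decide : u ≢ v → pos α u < pos α v → T (isRightEdge u v)
    decide u≢v u<v
      rewrite T⇒≡true u∈X | ¬T⇒≡false v∉X | T⇒≡true u~v | dec-no (u ≟ v) u≢v
            | dec-true (pos α u ℕ.≟ minN G (pos α) v) u-leftmost | dec-true (pos α u <? pos α v) u<v = tt

  isLeftEdge⇒ : ∀ {u v} → T (isLeftEdge u v) →
    T (memb X u) × ¬ T (memb X v) × pos α v ≡ minN G (pos α) u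
  isLeftEdge⇒ {u} {v} e with T-∧⁻ (inEα G α u v) e
  ... | inE , rest with T-∧⁻ (memb X u) rest
  ...   | u∈X , rest′ with T-∧⁻ (not (memb X v)) rest′
  ...     | v∉X , v<u with T-∨⁻ (proj₂ (T-∧⁻ (adj G u v) (proj₂ (T-∧⁻ (not ⌊ u ≟ v ⌋) inE))))
  ...       | inj₁ u-leftmost = contradiction
    (≤-trans (≤-reflexive (≡ᵇ⇒≡ (pos α u) _ u-leftmost)) (minN-≤-self G (pos α) v))
    (<⇒≱ (<ᵇ⇒< (pos α v) (pos α u) v<u))
  ...       | inj₂ v-leftmost = u∈X , T-not⁻ v∉X , ≡ᵇ⇒≡ _ _ v-leftmost

module SingletonSwap {n : ℕ} (G : Graph n) (α : Ordering n) (Y : Subset n) (x z : Fin n) {a c : ℕ}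
  (a≤c : a ≤ c)
  (posα-x : pos α x ≡ a)
  (Y-block : ∀ v → T (memb Y v) ⇔ InBlock a c (pos α v))
  (x~z : T (adj G x z))
  (z-leaf : ∀ {w} → T (adj G z w) → w ≡ x)
  (c<z : c < pos α z)
  where

  posα posβ : Fin n → ℕ
  posα = pos α
  posβ = swapYX α a (suc a) c

  minα minβ : Fin n → ℕ
  minα = minN G posα
  minβ = minN G posβ

  x∉Y : ¬ T (memb Y x)
  x∉Y x∈Y = <-irrefl (sym posα-x) (proj₁ (Equivalence.to (Y-block x) x∈Y))

  z∉Y : ¬ T (memb Y z)
  z∉Y z∈Y = <⇒≱ c<z (proj₂ (Equivalence.to (Y-block z) z∈Y))

  x≢z : x ≢ z
  x≢z refl = subst T (irrefl G x) x~z

  posβ-x : posβ x ≡ c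
  posβ-x = trans (cong (swapPos a (suc a) c) posα-x) (swapPos-at a≤c)

  posβ-Y : ∀ {v} → T (memb Y v) → suc (posβ v) ≡ posα v
  posβ-Y {v} v∈Y = let (a<v , v≤c) = Equivalence.to (Y-block v) v∈Y in swapPos-inside a<v v≤c

  posβ-fixed : ∀ {v} → v ≢ x → ¬ T (memb Y v) → posβ v ≡ posα v
  posβ-fixed {v} v≢x v∉Y with region a c (posα v)
  ... | before v<a     = swapPos-before {c = c} v<a
  ... | at v≡a         = contradiction (pos-injective α (trans v≡a (sym posα-x))) v≢x
  ... | inside a<v v≤c = contradiction (Equivalence.from (Y-block v) (a<v , v≤c)) v∉Y
  ... | after c<v      = swapPos-after a≤c c<v

  leftmost∈Y : Fin n → Bool
  leftmost∈Y v = does (inBlock? a c (minα v))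

  minα≤suc-minβ : ∀ v → minα v ≤ suc (minβ v)
  minα≤suc-minβ v with minN-attained G posβ v
  ... | w , w∈N[v] , minβ≡posβw =
    ≤-trans (minN-≤ G posα v w∈N[v])
            (≤-trans (≤-suc-swapPos a≤c (posα w)) (s≤s (≤-reflexive (sym minβ≡posβw))))

  minα≤minβ : ∀ v → ¬ InBlock a c (minα v) → minα v ≤ minβ v
  minα≤minβ v outside =
    ≤-minN G posβ v (λ w w∈N[v] → ≤-swapPos-outsideBlock a≤c outside (minN-≤ G posα v w∈N[v]))

  minα≤minβ+leftmost∈Y : ∀ v → minα v ≤ minβ v + indicator (leftmost∈Y v)
  minα≤minβ+leftmost∈Y v with inBlock? a c (minα v)
  ... | yes in-block rewrite dec-true (inBlock? a c (minα v)) in-block =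
    ≤-trans (minα≤suc-minβ v) (≤-reflexive (+-comm 1 (minβ v)))
  ... | no outside rewrite dec-false (inBlock? a c (minα v)) outside =
    ≤-trans (minα≤minβ v outside) (≤-reflexive (sym (+-identityʳ (minβ v))))

  leftCrossing rightCrossing : Fin n → Bool
  leftCrossing  v = memb Y v ∧ not (leftmost∈Y v)
  rightCrossing v = not (memb Y v) ∧ leftmost∈Y v

  crossings-∈Y : ∀ {v} → T (memb Y v) →
    indicator (leftCrossing v) + indicator (leftmost∈Y v) ≡ 1 × indicator (rightCrossing v) ≡ 0
  crossings-∈Y {v} v∈Y rewrite T⇒≡true v∈Y with leftmost∈Y v
  ... | true  = refl , refl
  ... | false = refl , refl

  crossings-∉Y : ∀ {v} → ¬ T (memb Y v) →
    indicator (leftCrossing v) ≡ 0 × indicator (rightCrossing v) ≡ indicator (leftmost∈Y v)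
  crossings-∉Y {v} v∉Y rewrite ¬T⇒≡false v∉Y = refl , refl

  chargeβ chargeα : Fin n → ℕ
  chargeβ v = posβ v ∸ minβ v + indicator (leftCrossing v)
  chargeα v = posα v ∸ minα v + indicator (rightCrossing v)

  charge-∈Y : ∀ {v} → T (memb Y v) → chargeβ v ≤ chargeα v
  charge-∈Y {v} v∈Y = clear-∸-≤ (minN-≤-self G posβ v) (minN-≤-self G posα v) (begin
    posβ v + minα v + indicator (leftCrossing v)
      ≤⟨ +-monoˡ-≤ _ (+-monoʳ-≤ (posβ v) (minα≤minβ+leftmost∈Y v)) ⟩
    posβ v + (minβ v + indicator (leftmost∈Y v)) + indicator (leftCrossing v)
      ≡⟨ regroup (posβ v) (minβ v) _ _ ⟩
    posβ v + minβ v + (indicator (leftCrossing v) + indicator (leftmost∈Y v))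
      ≡⟨ cong (posβ v + minβ v +_) (proj₁ (crossings-∈Y v∈Y)) ⟩
    posβ v + minβ v + 1
      ≡⟨ +-comm (posβ v + minβ v) 1 ⟩
    suc (posβ v) + minβ v
      ≡⟨ cong (_+ minβ v) (posβ-Y v∈Y) ⟩
    posα v + minβ v
      ≡⟨ +-identityʳ _ ⟨
    posα v + minβ v + 0
      ≡⟨ cong (posα v + minβ v +_) (proj₂ (crossings-∈Y v∈Y)) ⟨
    posα v + minβ v + indicator (rightCrossing v) ∎)
    where
    open ≤-Reasoning
    regroup : ∀ p m l q → p + (m + l) + q ≡ p + m + (q + l)
    regroup = solve-∀

  charge-fixed : ∀ {v} → v ≢ x → ¬ T (memb Y v) → chargeβ v ≤ chargeα v
  charge-fixed {v} v≢x v∉Y = clear-∸-≤ (minN-≤-self G posβ v) (minN-≤-self G posα v) (begin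
    posβ v + minα v + indicator (leftCrossing v)
      ≡⟨ cong₂ (λ p q → p + minα v + q) (posβ-fixed v≢x v∉Y) (proj₁ (crossings-∉Y v∉Y)) ⟩
    posα v + minα v + 0
      ≡⟨ +-identityʳ _ ⟩
    posα v + minα v
      ≤⟨ +-monoʳ-≤ (posα v) (minα≤minβ+leftmost∈Y v) ⟩
    posα v + (minβ v + indicator (leftmost∈Y v))
      ≡⟨ +-assoc (posα v) (minβ v) _ ⟨
    posα v + minβ v + indicator (leftmost∈Y v)
      ≡⟨ cong (posα v + minβ v +_) (proj₂ (crossings-∉Y v∉Y)) ⟨
    posα v + minβ v + indicator (rightCrossing v) ∎)
    where open ≤-Reasoning

  charge-x : chargeβ x ≤ chargeα x + (c ∸ a)
  charge-x = ≤-trans (clear-∸-≤ (minN-≤-self G posβ x) (minN-≤-self G posα x) (begin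
    posβ x + minα x + indicator (leftCrossing x)
      ≡⟨ cong₂ (λ p q → p + minα x + q) posβ-x (proj₁ (crossings-∉Y x∉Y)) ⟩
    c + minα x + 0
      ≡⟨ +-identityʳ _ ⟩
    c + minα x
      ≤⟨ +-monoʳ-≤ c (minα≤minβ x (λ (a<minα , _) → <⇒≱ a<minα minα-x≤a)) ⟩
    c + minβ x
      ≡⟨ cong (_+ minβ x) (m+[n∸m]≡n a≤c) ⟨
    a + (c ∸ a) + minβ x
      ≡⟨ swap-last a (c ∸ a) (minβ x) ⟩
    a + minβ x + (c ∸ a)
      ≤⟨ +-monoʳ-≤ (a + minβ x) (m≤n+m (c ∸ a) _) ⟩
    a + minβ x + (indicator (rightCrossing x) + (c ∸ a))
      ≡⟨ cong (λ p → p + minβ x + (indicator (rightCrossing x) + (c ∸ a))) posα-x ⟨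
    posα x + minβ x + (indicator (rightCrossing x) + (c ∸ a)) ∎))
    (≤-reflexive (sym (+-assoc (posα x ∸ minα x) _ (c ∸ a))))
    where
    open ≤-Reasoning
    minα-x≤a : minα x ≤ a
    minα-x≤a = ≤-trans (minN-≤-self G posα x) (≤-reflexive posα-x)
    swap-last : ∀ p q r → p + q + r ≡ p + r + q
    swap-last = solve-∀

  charge-z : chargeβ z + (c ∸ a) ≤ chargeα z
  charge-z = ≤-trans (≤-reflexive (+-assoc (posβ z ∸ minβ z) _ (c ∸ a)))
    (clear-∸-≤ (minN-≤-self G posβ z) (minN-≤-self G posα z) (begin
    posβ z + minα z + (indicator (leftCrossing z) + (c ∸ a))
      ≡⟨ cong₂ (λ p q → p + minα z + (q + (c ∸ a))) (posβ-fixed (x≢z ∘ sym) z∉Y) (proj₁ (crossings-∉Y z∉Y)) ⟩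
    posα z + minα z + (c ∸ a)
      ≡⟨ +-assoc (posα z) (minα z) (c ∸ a) ⟩
    posα z + (minα z + (c ∸ a))
      ≤⟨ +-monoʳ-≤ (posα z) (+-monoˡ-≤ (c ∸ a) minα-z≤a) ⟩
    posα z + (a + (c ∸ a))
      ≡⟨ cong (posα z +_) (m+[n∸m]≡n a≤c) ⟩
    posα z + c
      ≤⟨ +-monoʳ-≤ (posα z) c≤minβ-z ⟩
    posα z + minβ z
      ≤⟨ m≤m+n (posα z + minβ z) _ ⟩
    posα z + minβ z + indicator (rightCrossing z) ∎))
    where
    open ≤-Reasoning
    minα-z≤a : minα z ≤ a
    minα-z≤a = ≤-trans (minN-≤ G posα z (adj⇒inN G (subst T (adj-sym G x z) x~z))) (≤-reflexive posα-x)
    c≤posβ : ∀ w → T (inN G z w) → c ≤ posβ w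
    c≤posβ w w∈N[z] with inN⇒≡⊎adj G w∈N[z]
    ... | inj₁ refl = ≤-trans (<⇒≤ c<z) (≤-reflexive (sym (posβ-fixed (x≢z ∘ sym) z∉Y)))
    ... | inj₂ z~w  = ≤-reflexive (sym (trans (cong posβ (z-leaf z~w)) posβ-x))
    c≤minβ-z : c ≤ minβ z
    c≤minβ-z = ≤-minN G posβ z c≤posβ

  rightCrossing⇒rightEdge : ∀ v → T (rightCrossing v) → Σ[ u ∈ Fin n ] T (isRightEdge G α Y u v)
  rightCrossing⇒rightEdge v crossing with T-∧⁻ (not (memb Y v)) crossing | minN-attained G posα v
  ... | v∉Y , leftmost-inside | u , u∈N[v] , minα≡posαu =
    u , isRightEdge-intro G α Y u∈Y (T-not⁻ v∉Y) u~v (sym minα≡posαu)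
    where
    u∈Y : T (memb Y u)
    u∈Y = Equivalence.from (Y-block u)
      (subst (InBlock a c) minα≡posαu (T-does⁻ (inBlock? a c (minα v)) leftmost-inside))
    u~v : T (adj G u v)
    u~v with inN⇒≡⊎adj G u∈N[v]
    ... | inj₁ refl = contradiction u∈Y (T-not⁻ v∉Y)
    ... | inj₂ v~u  = subst T (adj-sym G v u) v~u

  ∑rightCrossing≤Er : sum (indicator ∘ rightCrossing) ≤ Er G α Y
  ∑rightCrossing≤Er = begin
    sum (indicator ∘ rightCrossing)
      ≤⟨ sum-mono-≤ (λ v → indicator-≤-sum (λ u → isRightEdge G α Y u v) (rightCrossing⇒rightEdge v)) ⟩
    ∑[ v < n ] ∑[ u < n ] indicator (isRightEdge G α Y u v)
      ≡⟨ ∑-comm (λ v u → indicator (isRightEdge G α Y u v)) ⟩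
    ∑[ u < n ] ∑[ v < n ] indicator (isRightEdge G α Y u v)
      ≡⟨ Er≡∑∑ G α Y ⟨
    Er G α Y ∎
    where open ≤-Reasoning

  leftCrossing-intro : ∀ {u} → T (memb Y u) → ¬ InBlock a c (minα u) → T (leftCrossing u)
  leftCrossing-intro {u} u∈Y outside rewrite T⇒≡true u∈Y | dec-false (inBlock? a c (minα u)) outside = tt

  leftEdge⇒leftCrossing : ∀ u v → T (isLeftEdge G α Y u v) → T (leftCrossing u)
  leftEdge⇒leftCrossing u v edge with isLeftEdge⇒ G α Y edge
  ... | u∈Y , v∉Y , posαv≡minα = leftCrossing-intro u∈Y
    (λ in-block → v∉Y (Equivalence.from (Y-block v) (subst (InBlock a c) (sym posαv≡minα) in-block)))

  El≤∑leftCrossing : El G α Y ≤ sum (indicator ∘ leftCrossing)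
  El≤∑leftCrossing = ≤-trans (≤-reflexive (El≡∑∑ G α Y))
    (sum-mono-≤ (λ u → sum-indicator-≤ (isLeftEdge G α Y u) (leftEdge⇒leftCrossing u) (leftEdge-unique u)))
    where
    leftEdge-unique : ∀ u v v′ → T (isLeftEdge G α Y u v) → T (isLeftEdge G α Y u v′) → v ≡ v′
    leftEdge-unique u v v′ e e′ = pos-injective α
      (trans (proj₂ (proj₂ (isLeftEdge⇒ G α Y {u} e))) (sym (proj₂ (proj₂ (isLeftEdge⇒ G α Y {u} e′)))))

  prf-swap≤prf : Er G α Y ≤ El G α Y → prfF G posβ ≤ prf G α
  prf-swap≤prf Er≤El = +-cancelʳ-≤ (sum P) (prfF G posβ) (prf G α) (begin
    prfF G posβ + sum P
      ≡⟨ cong (_+ sum P) (sumV≡sum (λ v → posβ v ∸ minβ v)) ⟩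
    sum (λ v → posβ v ∸ minβ v) + sum P
      ≡⟨ ∑-distrib-+ (λ v → posβ v ∸ minβ v) P ⟨
    sum chargeβ
      ≤⟨ sum-≤-transfer (c ∸ a) x≢z charge-x charge-z charge-elsewhere ⟩
    sum chargeα
      ≡⟨ ∑-distrib-+ (λ v → posα v ∸ minα v) Q ⟩
    sum (λ v → posα v ∸ minα v) + sum Q
      ≡⟨ cong (_+ sum Q) (sumV≡sum (λ v → posα v ∸ minα v)) ⟨
    prf G α + sum Q
      ≤⟨ +-monoʳ-≤ (prf G α) (≤-trans ∑rightCrossing≤Er (≤-trans Er≤El El≤∑leftCrossing)) ⟩
    prf G α + sum P ∎)
    where
    open ≤-Reasoning
    P Q : Fin n → ℕ
    P = indicator ∘ leftCrossing
    Q = indicator ∘ rightCrossing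
    charge-elsewhere : ∀ v → v ≢ x → v ≢ z → chargeβ v ≤ chargeα v
    charge-elsewhere v v≢x _ with T? (memb Y v)
    ... | yes v∈Y = charge-∈Y v∈Y
    ... | no  v∉Y = charge-fixed v≢x v∉Y

⁅x⁆-consecutive : ∀ {n} {α : Ordering n} {x : Fin n} {Y a b c} →
  ConsecutivePairAt α ⁅ x ⁆ Y a b c → pos α x ≡ a × b ≡ suc a
⁅x⁆-consecutive {α = α} {x} {a = a} {suc b′} (1≤a , s≤s a≤b′ , b<c , c≤n , X-block , _) =
  x-at ≤-refl a≤b′ , cong suc (trans (sym (x-at a≤b′ ≤-refl)) (x-at ≤-refl a≤b′))
  where
  x-at : ∀ {p} → a ≤ p → p ≤ b′ → pos α x ≡ p
  x-at {p} a≤p p≤b′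
    with pos-surjective α (≤-trans 1≤a a≤p) (≤-trans p≤b′ (≤-trans (n≤1+n b′) (<⇒≤ (<-≤-trans b<c c≤n))))
  ... | v , pos-v≡p = trans (cong (pos α) (sym v≡x)) pos-v≡p
    where
    v≡x : v ≡ x
    v≡x = memb-⁅⁆⇒≡ (Equivalence.from (X-block v)
      (subst (a ≤_) (sym pos-v≡p) a≤p , subst (_≤ b′) (sym pos-v≡p) p≤b′))

lemma3p2 : {n : ℕ} (G : Graph n) → Connected G → (α : Ordering n)
    → (x : Fin n) (Y : Subset n) (a b c : ℕ)
    → ConsecutivePairAt α ⁅ x ⁆ Y a b c
    → (z : Fin n) → T (adj G x z) → degree G z ≡ 1
    → (∀ y → T (memb Y y) → pos α y < pos α z)
    → Er G α Y ≤ El G α Y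
    → prfF G (swapYX α a b c) ≤ prf G α
lemma3p2 G _ α x Y a b c pair@(1≤a , a<b , b<c , c≤n , _ , Y-block) z x~z deg-z Y<z Er≤El
  with ⁅x⁆-consecutive {α = α} {x = x} {Y = Y} pair
... | posα-x , refl =
  SingletonSwap.prf-swap≤prf G α Y x z (<⇒≤ (<-trans a<b b<c)) posα-x Y-block x~z z-leaf c<z Er≤El
  where
  z-leaf : ∀ {w} → T (adj G z w) → w ≡ x
  z-leaf z~w = degree≡1⇒adj-unique G deg-z z~w (subst T (adj-sym G x z) x~z)
  c<z : c < pos α z
  c<z with pos-surjective α (≤-trans 1≤a (<⇒≤ (<-trans a<b b<c))) c≤n
  ... | v , pos-v≡c = subst (_< pos α z) pos-v≡c
    (Y<z v (Equivalence.from (Y-block v) (subst (a <_) (sym pos-v≡c) (<⇒≤ b<c) , ≤-reflexive pos-v≡c)))
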